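{- Let $k,\ell,n$ be positive integers with $\ell$ dividing $n$. Then in $\mathbb{Q}((T))$, $$\mathbf{B}^k(\ell T)\,\mathbf{B}(nT)=\ell^kT^k\,\mathbf{B}(nT)\,f^{(k)}_{\ell,n}(e^T)+\frac{n}{\ell}\,\mathbf{B}^{k+1}(\ell T)\,h^{(k)}_{\ell,n}(e^T).$$
   Context: Let $e^T=\sum_{i\ge 0}T^i/i!\in\mathbb{Q}[[T]]$ and $\mathbf{B}=\mathbf{B}(T)=T/(e^T-1)\in\mathbb{Q}[[T]]$; for $b\in\mathbb{Q}$, $\mathbf{B}(bT)$ denotes the power series obtained by substituting $bT$ for $T$, and $\mathbf{B}^j(bT)=(\mathbf{B}(bT))^j$. For a polynomial $g\in\mathbb{Q}[X]$, $g(e^T)$ denotes the result of substituting $e^T$ for $X$. For positive integers $k,N$, let $h^{(k)}_{1,N},f^{(k)}_{1,N}\in\mathbb{Q}[X]$ be the polynomials of degrees less than $k$ and less than $N-1$ respectively such that $$\frac{1}{(X-1)^k(1+X+\cdots+X^{N-1})}=\frac{h^{(k)}_{1,N}}{(X-1)^k}+\frac{f^{(k)}_{1,N}}{1+X+\cdots+X^{N-1}}.$$ For $\ell$ dividing $n$, set $h^{(k)}_{\ell,n}=h^{(k)}_{1,n/\ell}(X^\ell)$ and $f^{(k)}_{\ell,n}=f^{(k)}_{1,n/\ell}(X^\ell)$. -}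

module Defs where

open import Data.Nat as ℕ using (ℕ; zero; suc; _∸_; _≤?_)
open import Data.Integer using (+_)
open import Data.Rational using (ℚ; 0ℚ; 1ℚ; _+_; _*_; -_; _/_)
open import Data.Vec using (Vec; []; _∷_)
open import Relation.Nullary using (yes; no)
open import Relation.Binary.PropositionalEquality using (_≡_)

PS : Set
PS = ℕ → ℚ

_≈ₚ_ : PS → PS → Set
a ≈ₚ b = ∀ m → a m ≡ b m


sumTo : ℕ → (ℕ → ℚ) → ℚ
sumTo zero f = f zero
sumTo (suc n) f = sumTo n f + f (suc n)

powℚ : ℚ → ℕ → ℚ
powℚ b zero = 1ℚ
powℚ b (suc i) = b * powℚ b i

fromℕ : ℕ → ℚ
fromℕ m = + m / 1

zeroₚ : PS
zeroₚ _ = 0ℚ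

constₚ : ℚ → PS
constₚ c zero = c
constₚ c (suc _) = 0ℚ

oneₚ : PS
oneₚ = constₚ 1ℚ

monoₚ : ℕ → ℚ → PS
monoₚ zero c = constₚ c
monoₚ (suc k) c zero = 0ℚ
monoₚ (suc k) c (suc m) = monoₚ k c m

_⊕_ : PS → PS → PS
(a ⊕ b) m = a m + b m

_⊛_ : PS → PS → PS
(a ⊛ b) n = sumTo n (λ i → a i * b (n ∸ i))

infixl 6 _⊕_
infixl 7 _⊛_

powₚ : PS → ℕ → PS
powₚ a zero = oneₚ
powₚ a (suc j) = a ⊛ powₚ a j

-- substitution T ↦ bT
scaleₚ : ℚ → PS → PS
scaleₚ b a i = powℚ b i * a i

-- e^T = ∑ T^i / i!
expₚ : PS
expₚ zero = 1ℚ
expₚ (suc i) = expₚ i * (+ 1 / suc i)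

-- Multiplicative inverse of a series a with constant term 1:
-- c_0 = 1, c_n = - ∑_{i=1}^{n} a_i c_{n-i}.
-- invTab a n m is c_m for m ≤ n.
invTab : PS → ℕ → ℕ → ℚ
invTab a zero m = 1ℚ
invTab a (suc n) m with m ≤? n
... | yes _ = invTab a n m
... | no _ = - sumTo n (λ i → a (suc i) * invTab a n (n ∸ i))

inv1ₚ : PS → PS
inv1ₚ a m = invTab a m m

-- (e^T - 1)/T = ∑ T^i/(i+1)!
expShiftₚ : PS
expShiftₚ i = expₚ (suc i)

-- B(T) = T/(e^T - 1)
Bₚ : PS
Bₚ = inv1ₚ expShiftₚ

-- Polynomials of degree < m as coefficient vectors (constant term first),
-- viewed as power series.
polyₚ : ∀ {m} → Vec ℚ m → PS
polyₚ [] _ = 0ℚ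
polyₚ (c ∷ cs) zero = c
polyₚ (c ∷ cs) (suc i) = polyₚ cs i

-- g(P): substitute a power series P for X in polynomial g (Horner).
evalAtₚ : ∀ {m} → Vec ℚ m → PS → PS
evalAtₚ [] P = zeroₚ
evalAtₚ (c ∷ cs) P = constₚ c ⊕ P ⊛ evalAtₚ cs P

-- 1 + X + ... + X^{N-1}
cycloSumₚ : ℕ → PS
cycloSumₚ N i with suc i ≤? N
... | yes _ = 1ℚ
... | no _ = 0ℚ

xMinus1ₚ : PS
xMinus1ₚ zero = - 1ℚ
xMinus1ₚ (suc zero) = 1ℚ
xMinus1ₚ (suc (suc _)) = 0ℚ

-- h (deg < k) and f (deg < N-1) satisfy
--   1/((X-1)^k (1+...+X^{N-1})) = h/(X-1)^k + f/(1+...+X^{N-1}),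
-- i.e. (clearing denominators) h·(1+...+X^{N-1}) + f·(X-1)^k = 1.
IsPartialFraction : (k N : ℕ) → Vec ℚ k → Vec ℚ (N ∸ 1) → Set
IsPartialFraction k N h f =
  (polyₚ h ⊛ cycloSumₚ N ⊕ polyₚ f ⊛ powₚ xMinus1ₚ k) ≈ₚ oneₚ

module Submission where

-- Write E = e^{ℓT}, L = B(ℓT), M = B(nT). Three facts about these series
-- carry the argument:
--   (a) L·(E - 1) = ℓT, hence ℓ^k T^k = L^k (E-1)^k;
--   (b) E^N = e^{nT}, so M·(E^N - 1) = nT; dividing by (a) and using the
--       geometric sum (E-1)[N]_E = E^N - 1 gives M·[N]_E = N·L;
--   (c) the hypothesis on h, f is an identity of polynomials, so it stays true
--       after substituting X := E.
-- Multiplying L^k M by 1 = h(E)[N]_E + f(E)(E-1)^k and rewriting with (a),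
-- (b) yields the right-hand side. Existence of h and f is proved separately, by
-- induction on k, dividing by X - 1 with remainder.

open import Defs
open import Data.Nat using (ℕ; suc; _≤_; _^_; _/_; _∸_; NonZero)
open import Data.Nat.Divisibility using (_∣_)
open import Data.Rational using (ℚ)
open import Data.Vec using (Vec)
open import Data.Product using (Σ-syntax; _×_)

open import Data.Nat as ℕ using (zero; z≤n; s≤s; _≤?_; >-nonZero)
import Data.Nat.Properties as ℕP
open import Data.Nat.Divisibility using (∣⇒≤)
open import Data.Nat.DivMod using (m*[n/m]≡n; m≥n⇒m/n>0)
open import Data.Nat.Coprimality using (1-coprimeTo) renaming (sym to coprime-sym)
import Data.Integer as ℤ
import Data.Integer.Properties as ℤP
open import Data.Rational using (0ℚ; 1ℚ; _+_; _*_; -_; 1/_; mkℚ)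
  renaming (_/_ to _÷_; NonZero to NonZeroℚ)
open import Data.Rational.Properties
  using ( +-assoc; +-comm; +-identityˡ; +-identityʳ; +-inverseˡ; +-inverseʳ
        ; *-assoc; *-comm; *-identityˡ; *-identityʳ; *-zeroˡ; *-zeroʳ
        ; *-distribˡ-+; *-distribʳ-+; neg-distrib-+; neg-distribˡ-*
        ; *-inverseˡ; *-inverseʳ; _≟_; normalize-coprime; /-cong)
open import Data.Rational.Solver using (module +-*-Solver)
open import Data.List using (List; []; _∷_; replicate)
open import Data.List.Relation.Unary.All using (All; []; _∷_)
open import Data.Vec using (toList) renaming ([] to []ᵥ; _∷_ to _∷ᵥ_)
open import Data.Maybe using (Maybe; just; nothing)
open import Data.Product using (_,_)
open import Data.Sum using (inj₁; inj₂)
open import Data.Empty using (⊥-elim)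
open import Function using (_∘_)
open import Relation.Nullary using (yes; no; ¬_)
open import Relation.Binary.PropositionalEquality
open import Relation.Binary.Bundles using (Setoid)
open import Algebra.Structures using (IsCommutativeSemiring)
open import Algebra.Bundles using (RawRing)
import Algebra.Solver.Ring.AlmostCommutativeRing as ACR
import Algebra.Solver.Ring
import Relation.Binary.Reasoning.Setoid

sumTo-cong : ∀ n {f g : ℕ → ℚ} → (∀ i → i ≤ n → f i ≡ g i) → sumTo n f ≡ sumTo n g
sumTo-cong zero eq = eq 0 z≤n
sumTo-cong (suc n) eq =
  cong₂ _+_ (sumTo-cong n (λ i i≤n → eq i (ℕP.m≤n⇒m≤1+n i≤n))) (eq (suc n) ℕP.≤-refl)

sumTo-+ : ∀ n f g → sumTo n (λ i → f i + g i) ≡ sumTo n f + sumTo n g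
sumTo-+ zero f g = refl
sumTo-+ (suc n) f g rewrite sumTo-+ n f g =
  +-*-Solver.solve 4 (λ a b c d → (a :+ b) :+ (c :+ d) := (a :+ c) :+ (b :+ d)) refl
    (sumTo n f) (sumTo n g) (f (suc n)) (g (suc n))
  where open +-*-Solver

sumTo-*ˡ : ∀ n c f → sumTo n (λ i → c * f i) ≡ c * sumTo n f
sumTo-*ˡ zero c f = refl
sumTo-*ˡ (suc n) c f rewrite sumTo-*ˡ n c f = sym (*-distribˡ-+ c (sumTo n f) (f (suc n)))

sumTo-*ʳ : ∀ n c f → sumTo n (λ i → f i * c) ≡ sumTo n f * c
sumTo-*ʳ zero c f = refl
sumTo-*ʳ (suc n) c f rewrite sumTo-*ʳ n c f = sym (*-distribʳ-+ c (sumTo n f) (f (suc n)))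

sumTo-neg : ∀ n f → sumTo n (λ i → - f i) ≡ - sumTo n f
sumTo-neg zero f = refl
sumTo-neg (suc n) f rewrite sumTo-neg n f = sym (neg-distrib-+ (sumTo n f) (f (suc n)))

sumTo-zero : ∀ n f → (∀ i → i ≤ n → f i ≡ 0ℚ) → sumTo n f ≡ 0ℚ
sumTo-zero n f eq = trans (sumTo-cong n eq) (all-zero n)
  where
  all-zero : ∀ n → sumTo n (λ _ → 0ℚ) ≡ 0ℚ
  all-zero zero = refl
  all-zero (suc n) rewrite all-zero n = refl

sumTo-suc : ∀ n f → sumTo (suc n) f ≡ f 0 + sumTo n (f ∘ suc)
sumTo-suc zero f = refl
sumTo-suc (suc n) f rewrite sumTo-suc n f = +-assoc (f 0) (sumTo n (f ∘ suc)) (f (suc (suc n)))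

sumTo-reverse : ∀ n f → sumTo n f ≡ sumTo n (λ i → f (n ∸ i))
sumTo-reverse zero f = refl
sumTo-reverse (suc n) f = begin
  sumTo n f + f (suc n)                    ≡⟨ +-comm (sumTo n f) (f (suc n)) ⟩
  f (suc n) + sumTo n f                    ≡⟨ cong (f (suc n) +_) (sumTo-reverse n f) ⟩
  f (suc n) + sumTo n (λ i → f (n ∸ i))    ≡⟨ sym (sumTo-suc n (λ i → f (suc n ∸ i))) ⟩
  sumTo (suc n) (λ i → f (suc n ∸ i))      ∎
  where open ≡-Reasoning

sumTo-triangle : ∀ n (G : ℕ → ℕ → ℚ) →
  sumTo n (λ i → sumTo i (λ j → G j (i ∸ j))) ≡ sumTo n (λ j → sumTo (n ∸ j) (G j))
sumTo-triangle zero G = refl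
sumTo-triangle (suc n) G = begin
  sumTo n (λ i → sumTo i (λ j → G j (i ∸ j))) + (sumTo n (λ j → G j (suc n ∸ j)) + G (suc n) (n ∸ n))
    ≡⟨ cong (_+ (sumTo n (λ j → G j (suc n ∸ j)) + G (suc n) (n ∸ n))) (sumTo-triangle n G) ⟩
  sumTo n (λ j → sumTo (n ∸ j) (G j)) + (sumTo n (λ j → G j (suc n ∸ j)) + G (suc n) (n ∸ n))
    ≡⟨ sym (+-assoc (sumTo n (λ j → sumTo (n ∸ j) (G j))) (sumTo n (λ j → G j (suc n ∸ j))) (G (suc n) (n ∸ n))) ⟩
  (sumTo n (λ j → sumTo (n ∸ j) (G j)) + sumTo n (λ j → G j (suc n ∸ j))) + G (suc n) (n ∸ n)
    ≡⟨ cong (_+ G (suc n) (n ∸ n)) (sym (sumTo-+ n (λ j → sumTo (n ∸ j) (G j)) (λ j → G j (suc n ∸ j)))) ⟩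
  sumTo n (λ j → sumTo (n ∸ j) (G j) + G j (suc n ∸ j)) + G (suc n) (n ∸ n)
    ≡⟨ cong₂ _+_ (sumTo-cong n extend-row) (last-row (n ∸ n) (ℕP.n∸n≡0 n)) ⟩
  sumTo n (λ j → sumTo (suc n ∸ j) (G j)) + sumTo (n ∸ n) (G (suc n)) ∎
  where
  open ≡-Reasoning
  extend-row : ∀ j → j ≤ n → sumTo (n ∸ j) (G j) + G j (suc n ∸ j) ≡ sumTo (suc n ∸ j) (G j)
  extend-row j j≤n rewrite ℕP.+-∸-assoc 1 j≤n = refl
  last-row : ∀ m → m ≡ 0 → G (suc n) m ≡ sumTo m (G (suc n))
  last-row .0 refl = refl

-- The ring ℚ[[T]] of formal power series under coefficientwise equality.

infix 4 _≈_
_≈_ : PS → PS → Set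
_≈_ = _≈ₚ_

≈-refl : ∀ {a} → a ≈ a
≈-refl _ = refl

≈-sym : ∀ {a b} → a ≈ b → b ≈ a
≈-sym p m = sym (p m)

≈-trans : ∀ {a b c} → a ≈ b → b ≈ c → a ≈ c
≈-trans p q m = trans (p m) (q m)

PS-setoid : Setoid _ _
PS-setoid = record
  { Carrier = PS ; _≈_ = _≈_
  ; isEquivalence = record { refl = ≈-refl ; sym = ≈-sym ; trans = ≈-trans } }

module ≈-Reasoning = Relation.Binary.Reasoning.Setoid PS-setoid

negₚ : PS → PS
negₚ a i = - a i

⊕-cong : ∀ {a a′ b b′} → a ≈ a′ → b ≈ b′ → a ⊕ b ≈ a′ ⊕ b′
⊕-cong p q m = cong₂ _+_ (p m) (q m)

⊛-cong : ∀ {a a′ b b′} → a ≈ a′ → b ≈ b′ → a ⊛ b ≈ a′ ⊛ b′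
⊛-cong p q m = sumTo-cong m (λ i _ → cong₂ _*_ (p i) (q (m ∸ i)))

⊛-comm : ∀ a b → a ⊛ b ≈ b ⊛ a
⊛-comm a b m = trans (sumTo-reverse m (λ i → a i * b (m ∸ i))) (sumTo-cong m swap)
  where
  swap : ∀ i → i ≤ m → a (m ∸ i) * b (m ∸ (m ∸ i)) ≡ b i * a (m ∸ i)
  swap i i≤m rewrite ℕP.m∸[m∸n]≡n i≤m = *-comm (a (m ∸ i)) (b i)

⊛-assoc : ∀ a b c → (a ⊛ b) ⊛ c ≈ a ⊛ (b ⊛ c)
⊛-assoc a b c m = begin
  sumTo m (λ i → sumTo i (λ j → a j * b (i ∸ j)) * c (m ∸ i))
    ≡⟨ sumTo-cong m (λ i _ → sym (sumTo-*ʳ i _ _)) ⟩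
  sumTo m (λ i → sumTo i (λ j → a j * b (i ∸ j) * c (m ∸ i)))
    ≡⟨ sumTo-cong m (λ i _ → sumTo-cong i regroup) ⟩
  sumTo m (λ i → sumTo i (λ j → G j (i ∸ j)))
    ≡⟨ sumTo-triangle m G ⟩
  sumTo m (λ j → sumTo (m ∸ j) (G j))
    ≡⟨ sumTo-cong m (λ j _ → trans (sumTo-cong (m ∸ j) (reassoc j)) (sumTo-*ˡ (m ∸ j) (a j) _)) ⟩
  sumTo m (λ j → a j * sumTo (m ∸ j) (λ t → b t * c ((m ∸ j) ∸ t))) ∎
  where
  open ≡-Reasoning
  G : ℕ → ℕ → ℚ
  G j t = a j * b t * c (m ∸ (j ℕ.+ t))
  regroup : ∀ {i} j → j ≤ i → a j * b (i ∸ j) * c (m ∸ i) ≡ G j (i ∸ j)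
  regroup j j≤i rewrite ℕP.m+[n∸m]≡n j≤i = refl
  reassoc : ∀ j t → t ≤ m ∸ j → G j t ≡ a j * (b t * c ((m ∸ j) ∸ t))
  reassoc j t _ rewrite ℕP.∸-+-assoc m j t = *-assoc (a j) (b t) _

⊛-distribˡ : ∀ a b c → a ⊛ (b ⊕ c) ≈ a ⊛ b ⊕ a ⊛ c
⊛-distribˡ a b c m =
  trans (sumTo-cong m (λ i _ → *-distribˡ-+ (a i) (b (m ∸ i)) (c (m ∸ i)))) (sumTo-+ m _ _)

⊛-distribʳ : ∀ a b c → (b ⊕ c) ⊛ a ≈ b ⊛ a ⊕ c ⊛ a
⊛-distribʳ a b c m =
  trans (sumTo-cong m (λ i _ → *-distribʳ-+ (a (m ∸ i)) (b i) (c i))) (sumTo-+ m _ _)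

⊛-identityˡ : ∀ a → oneₚ ⊛ a ≈ a
⊛-identityˡ a zero = *-identityˡ _
⊛-identityˡ a (suc m) = begin
  sumTo (suc m) (λ i → oneₚ i * a (suc m ∸ i))
    ≡⟨ sumTo-suc m _ ⟩
  1ℚ * a (suc m) + sumTo m (λ i → 0ℚ * a (m ∸ i))
    ≡⟨ cong₂ _+_ (*-identityˡ (a (suc m))) (sumTo-zero m _ (λ i _ → *-zeroˡ (a (m ∸ i)))) ⟩
  a (suc m) + 0ℚ
    ≡⟨ +-identityʳ (a (suc m)) ⟩
  a (suc m) ∎
  where open ≡-Reasoning

⊛-identityʳ : ∀ a → a ⊛ oneₚ ≈ a
⊛-identityʳ a = ≈-trans (⊛-comm a oneₚ) (⊛-identityˡ a)

⊛-zeroˡ : ∀ a → zeroₚ ⊛ a ≈ zeroₚ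
⊛-zeroˡ a m = sumTo-zero m _ (λ i _ → *-zeroˡ (a (m ∸ i)))

⊛-zeroʳ : ∀ a → a ⊛ zeroₚ ≈ zeroₚ
⊛-zeroʳ a m = sumTo-zero m _ (λ i _ → *-zeroʳ (a i))

neg-⊛ : ∀ a b → negₚ a ⊛ b ≈ negₚ (a ⊛ b)
neg-⊛ a b m =
  trans (sumTo-cong m (λ i _ → sym (neg-distribˡ-* (a i) (b (m ∸ i))))) (sumTo-neg m _)

PS-isCommutativeSemiring : IsCommutativeSemiring _≈_ _⊕_ _⊛_ zeroₚ oneₚ
PS-isCommutativeSemiring = record
  { isSemiring = record
    { isSemiringWithoutAnnihilatingZero = record
      { +-isCommutativeMonoid = record
        { isMonoid = record
          { isSemigroup = record
            { isMagma = record
              { isEquivalence = Setoid.isEquivalence PS-setoid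
              ; ∙-cong = ⊕-cong }
            ; assoc = λ a b c m → +-assoc (a m) (b m) (c m) }
          ; identity = (λ a m → +-identityˡ (a m)) , (λ a m → +-identityʳ (a m)) }
        ; comm = λ a b m → +-comm (a m) (b m) }
      ; *-cong = ⊛-cong
      ; *-assoc = ⊛-assoc
      ; *-identity = ⊛-identityˡ , ⊛-identityʳ
      ; distrib = ⊛-distribˡ , ⊛-distribʳ }
    ; zero = ⊛-zeroˡ , ⊛-zeroʳ }
  ; *-comm = ⊛-comm }

-- ℚ[[T]] as an almost-commutative ring, with ℚ embedded as constant series;
-- this is what the ring solver (PS-Solver below) needs.
PS-ring : ACR.AlmostCommutativeRing _ _
PS-ring = record
  { Carrier = PS ; _≈_ = _≈_ ; _+_ = _⊕_ ; _*_ = _⊛_ ; -_ = negₚ ; 0# = zeroₚ ; 1# = oneₚ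
  ; isAlmostCommutativeRing = record
    { isCommutativeSemiring = PS-isCommutativeSemiring
    ; -‿cong = λ p m → cong -_ (p m)
    ; -‿*-distribˡ = neg-⊛
    ; -‿+-comm = λ a b m → sym (neg-distrib-+ (a m) (b m)) } }

ℚ-rawRing : RawRing _ _
ℚ-rawRing = record
  { Carrier = ℚ ; _≈_ = _≡_ ; _+_ = _+_ ; _*_ = _*_ ; -_ = -_ ; 0# = 0ℚ ; 1# = 1ℚ }

const-+ : ∀ c d → constₚ (c + d) ≈ constₚ c ⊕ constₚ d
const-+ c d zero = refl
const-+ c d (suc m) = refl

const-* : ∀ c d → constₚ (c * d) ≈ constₚ c ⊛ constₚ d
const-* c d zero = refl
const-* c d (suc m) = sym (sumTo-zero (suc m) _ vanish)
  where
  vanish : ∀ i → i ≤ suc m → constₚ c i * constₚ d (suc m ∸ i) ≡ 0ℚ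
  vanish zero _ = *-zeroʳ c
  vanish (suc i) _ = *-zeroˡ (constₚ d (m ∸ i))

const-homomorphism : ℚ-rawRing ACR.-Raw-AlmostCommutative⟶ PS-ring
const-homomorphism = record
  { ⟦_⟧ = constₚ
  ; +-homo = const-+
  ; *-homo = const-*
  ; -‿homo = λ { c zero → refl ; c (suc m) → refl }
  ; 0-homo = λ { zero → refl ; (suc m) → refl }
  ; 1-homo = λ _ → refl }

const-≟ : ∀ c d → Maybe (constₚ c ≈ constₚ d)
const-≟ c d with c ≟ d
... | yes refl = just ≈-refl
... | no _ = nothing

module PS-Solver = Algebra.Solver.Ring ℚ-rawRing PS-ring const-homomorphism const-≟

Tₚ : PS
Tₚ = monoₚ 1 1ℚ

T⊛-coeff-zero : ∀ a → (Tₚ ⊛ a) zero ≡ 0ℚ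
T⊛-coeff-zero a = *-zeroˡ (a 0)

T⊛-coeff-suc : ∀ a m → (Tₚ ⊛ a) (suc m) ≡ a m
T⊛-coeff-suc a m = begin
  sumTo (suc m) (λ i → Tₚ i * a (suc m ∸ i))
    ≡⟨ sumTo-suc m (λ i → Tₚ i * a (suc m ∸ i)) ⟩
  0ℚ * a (suc m) + (oneₚ ⊛ a) m
    ≡⟨ cong₂ _+_ (*-zeroˡ (a (suc m))) (⊛-identityˡ a m) ⟩
  0ℚ + a m
    ≡⟨ +-identityˡ (a m) ⟩
  a m ∎
  where open ≡-Reasoning

T-cancel : ∀ {a b} → Tₚ ⊛ a ≈ Tₚ ⊛ b → a ≈ b
T-cancel {a} {b} p m = trans (sym (T⊛-coeff-suc a m)) (trans (p (suc m)) (T⊛-coeff-suc b m))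

split-constant-term : ∀ a → a ≈ constₚ (a 0) ⊕ Tₚ ⊛ (a ∘ suc)
split-constant-term a zero = sym (trans (cong (a 0 +_) (T⊛-coeff-zero (a ∘ suc))) (+-identityʳ (a 0)))
split-constant-term a (suc m) = sym (trans (cong (0ℚ +_) (T⊛-coeff-suc (a ∘ suc) m)) (+-identityˡ (a (suc m))))

const⊛-coeff : ∀ c a m → (constₚ c ⊛ a) m ≡ c * a m
const⊛-coeff c a zero = refl
const⊛-coeff c a (suc m) = begin
  sumTo (suc m) (λ i → constₚ c i * a (suc m ∸ i))
    ≡⟨ sumTo-suc m (λ i → constₚ c i * a (suc m ∸ i)) ⟩
  c * a (suc m) + sumTo m (λ i → 0ℚ * a (m ∸ i))
    ≡⟨ cong (c * a (suc m) +_) (sumTo-zero m _ (λ i _ → *-zeroˡ (a (m ∸ i)))) ⟩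
  c * a (suc m) + 0ℚ
    ≡⟨ +-identityʳ _ ⟩
  c * a (suc m) ∎
  where open ≡-Reasoning

*-cancelˡ : ∀ (c : ℚ) .{{_ : NonZeroℚ c}} {x y} → c * x ≡ c * y → x ≡ y
*-cancelˡ c {x} {y} p = begin
  x                ≡⟨ sym (*-identityˡ x) ⟩
  1ℚ * x           ≡⟨ cong (_* x) (sym (*-inverseˡ c)) ⟩
  (1/ c * c) * x   ≡⟨ *-assoc (1/ c) c x ⟩
  1/ c * (c * x)   ≡⟨ cong (1/ c *_) p ⟩
  1/ c * (c * y)   ≡⟨ sym (*-assoc (1/ c) c y) ⟩
  (1/ c * c) * y   ≡⟨ cong (_* y) (*-inverseˡ c) ⟩
  1ℚ * y           ≡⟨ *-identityˡ y ⟩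
  y                ∎
  where open ≡-Reasoning

const-cancel : ∀ c .{{_ : NonZeroℚ c}} {a b} → constₚ c ⊛ a ≈ constₚ c ⊛ b → a ≈ b
const-cancel c {a} {b} p m =
  *-cancelˡ c (trans (sym (const⊛-coeff c a m)) (trans (p m) (const⊛-coeff c b m)))

fromℕ-normal : ∀ m → fromℕ m ≡ mkℚ (ℤ.+ m) 0 (coprime-sym (1-coprimeTo m))
fromℕ-normal m = normalize-coprime _

fromℕ-suc : ∀ m → fromℕ (suc m) ≡ 1ℚ + fromℕ m
fromℕ-suc m rewrite fromℕ-normal m =
  /-cong {ℤ.+ suc m} (cong (λ x → ℤ.+ 1 ℤ.+ x) (sym (ℤP.*-identityʳ (ℤ.+ m)))) refl

fromℕ-+ : ∀ a b → fromℕ (a ℕ.+ b) ≡ fromℕ a + fromℕ b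
fromℕ-+ zero b = sym (+-identityˡ (fromℕ b))
fromℕ-+ (suc a) b rewrite fromℕ-suc (a ℕ.+ b) | fromℕ-+ a b | fromℕ-suc a =
  sym (+-assoc 1ℚ (fromℕ a) (fromℕ b))

fromℕ-* : ∀ a b → fromℕ (a ℕ.* b) ≡ fromℕ a * fromℕ b
fromℕ-* zero b = sym (*-zeroˡ (fromℕ b))
fromℕ-* (suc a) b rewrite fromℕ-+ b (a ℕ.* b) | fromℕ-* a b | fromℕ-suc a =
  +-*-Solver.solve 2 (λ x y → y :+ x :* y := (con 1ℚ :+ x) :* y) refl (fromℕ a) (fromℕ b)
  where open +-*-Solver

fromℕ-nonZero : ∀ m .{{_ : NonZero m}} → NonZeroℚ (fromℕ m)
fromℕ-nonZero (suc m) rewrite fromℕ-normal (suc m) = _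

-- (m+1) · 1/(m+1) = 1, with 1/(m+1) written as in the definition of expₚ.
fromℕ-inverse : ∀ m → fromℕ (suc m) * (ℤ.+ 1 ÷ suc m) ≡ 1ℚ
fromℕ-inverse m rewrite fromℕ-normal (suc m) | normalize-coprime {1} {m} (1-coprimeTo (suc m)) =
  *-inverseʳ (mkℚ (ℤ.+ suc m) 0 (coprime-sym (1-coprimeTo (suc m))))

powℚ-+ : ∀ c i j → powℚ c (i ℕ.+ j) ≡ powℚ c i * powℚ c j
powℚ-+ c zero j = sym (*-identityˡ _)
powℚ-+ c (suc i) j rewrite powℚ-+ c i j = sym (*-assoc c (powℚ c i) (powℚ c j))

powℚ-fromℕ : ∀ a k → powℚ (fromℕ a) k ≡ fromℕ (a ^ k)
powℚ-fromℕ a zero = refl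
powℚ-fromℕ a (suc k) rewrite powℚ-fromℕ a k = sym (fromℕ-* a (a ^ k))

powℚ-one : ∀ i → powℚ 1ℚ i ≡ 1ℚ
powℚ-one zero = refl
powℚ-one (suc i) rewrite powℚ-one i = refl

scale-cong : ∀ c {a b} → a ≈ b → scaleₚ c a ≈ scaleₚ c b
scale-cong c p i = cong (powℚ c i *_) (p i)

scale-congˡ : ∀ {c d} a → c ≡ d → scaleₚ c a ≈ scaleₚ d a
scale-congˡ a refl = ≈-refl

scale-⊕ : ∀ c a b → scaleₚ c (a ⊕ b) ≈ scaleₚ c a ⊕ scaleₚ c b
scale-⊕ c a b i = *-distribˡ-+ (powℚ c i) (a i) (b i)

scale-⊛ : ∀ c a b → scaleₚ c (a ⊛ b) ≈ scaleₚ c a ⊛ scaleₚ c b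
scale-⊛ c a b m = trans (sym (sumTo-*ˡ m (powℚ c m) _)) (sumTo-cong m distribute)
  where
  distribute : ∀ i → i ≤ m → powℚ c m * (a i * b (m ∸ i)) ≡ (powℚ c i * a i) * (powℚ c (m ∸ i) * b (m ∸ i))
  distribute i i≤m rewrite sym (cong (powℚ c) (ℕP.m+[n∸m]≡n i≤m)) | powℚ-+ c i (m ∸ i) =
    +-*-Solver.solve 4 (λ x y u v → (x :* y) :* (u :* v) := (x :* u) :* (y :* v)) refl
      (powℚ c i) (powℚ c (m ∸ i)) (a i) (b (m ∸ i))
    where open +-*-Solver

scale-const : ∀ c d → scaleₚ c (constₚ d) ≈ constₚ d
scale-const c d zero = *-identityˡ d
scale-const c d (suc i) = *-zeroʳ (powℚ c (suc i))

scale-T : ∀ c → scaleₚ c Tₚ ≈ constₚ c ⊛ Tₚ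
scale-T c zero = trans (*-zeroʳ 1ℚ) (sym (*-zeroʳ c))
scale-T c (suc zero) = trans (*-identityʳ (c * 1ℚ)) (sym (const⊛-coeff c Tₚ 1))
scale-T c (suc (suc i)) = trans (*-zeroʳ (powℚ c (suc (suc i)))) (sym (trans (const⊛-coeff c Tₚ (suc (suc i))) (*-zeroʳ c)))

scale-one : ∀ a → scaleₚ 1ℚ a ≈ a
scale-one a i rewrite powℚ-one i = *-identityˡ (a i)

pow-cong : ∀ {a b} k → a ≈ b → powₚ a k ≈ powₚ b k
pow-cong zero p = ≈-refl
pow-cong (suc k) p = ⊛-cong p (pow-cong k p)

pow-+ : ∀ a i j → powₚ a (i ℕ.+ j) ≈ powₚ a i ⊛ powₚ a j
pow-+ a zero j = ≈-sym (⊛-identityˡ (powₚ a j))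
pow-+ a (suc i) j = ≈-trans (⊛-cong (≈-refl {a}) (pow-+ a i j)) (≈-sym (⊛-assoc a (powₚ a i) (powₚ a j)))

pow-* : ∀ a i j → powₚ a (i ℕ.* j) ≈ powₚ (powₚ a i) j
pow-* a i zero rewrite ℕP.*-zeroʳ i = ≈-refl
pow-* a i (suc j) rewrite ℕP.*-suc i j = ≈-trans (pow-+ a i (i ℕ.* j)) (⊛-cong (≈-refl {powₚ a i}) (pow-* a i j))

pow-⊛ : ∀ a b k → powₚ (a ⊛ b) k ≈ powₚ a k ⊛ powₚ b k
pow-⊛ a b zero = ≈-sym (⊛-identityˡ oneₚ)
pow-⊛ a b (suc k) = ≈-trans (⊛-cong (≈-refl {a ⊛ b}) (pow-⊛ a b k))
  (solve 4 (λ a b x y → (a :* b) :* (x :* y) := (a :* x) :* (b :* y)) ≈-refl a b (powₚ a k) (powₚ b k))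
  where open PS-Solver

const-pow : ∀ c k → constₚ (powℚ c k) ≈ powₚ (constₚ c) k
const-pow c zero = ≈-refl
const-pow c (suc k) = ≈-trans (const-* c (powℚ c k)) (⊛-cong (≈-refl {constₚ c}) (const-pow c k))

mono≈const⊛T^k : ∀ k c → monoₚ k c ≈ constₚ c ⊛ powₚ Tₚ k
mono≈const⊛T^k zero c = ≈-sym (⊛-identityʳ (constₚ c))
mono≈const⊛T^k (suc k) c zero =
  sym (trans (const⊛-coeff c (Tₚ ⊛ powₚ Tₚ k) 0) (trans (cong (c *_) (T⊛-coeff-zero (powₚ Tₚ k))) (*-zeroʳ c)))
mono≈const⊛T^k (suc k) c (suc m) = begin
  monoₚ k c m                         ≡⟨ mono≈const⊛T^k k c m ⟩
  (constₚ c ⊛ powₚ Tₚ k) m            ≡⟨ const⊛-coeff c (powₚ Tₚ k) m ⟩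
  c * powₚ Tₚ k m                     ≡⟨ cong (c *_) (sym (T⊛-coeff-suc (powₚ Tₚ k) m)) ⟩
  c * (Tₚ ⊛ powₚ Tₚ k) (suc m)        ≡⟨ sym (const⊛-coeff c (Tₚ ⊛ powₚ Tₚ k) (suc m)) ⟩
  (constₚ c ⊛ (Tₚ ⊛ powₚ Tₚ k)) (suc m) ∎
  where open ≡-Reasoning

-- The exponential law. Θ = T·d/dT acts on coefficients by a_i ↦ i·a_i; it is
-- a derivation, and a series F with T F' = cT·F is determined by F(0).

Θ : PS → PS
Θ a i = fromℕ i * a i

Θ-⊛ : ∀ a b → Θ (a ⊛ b) ≈ Θ a ⊛ b ⊕ a ⊛ Θ b
Θ-⊛ a b m = trans (sym (sumTo-*ˡ m (fromℕ m) _)) (trans (sumTo-cong m leibniz) (sumTo-+ m _ _))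
  where
  leibniz : ∀ i → i ≤ m →
    fromℕ m * (a i * b (m ∸ i)) ≡ (fromℕ i * a i) * b (m ∸ i) + a i * (fromℕ (m ∸ i) * b (m ∸ i))
  leibniz i i≤m rewrite sym (cong fromℕ (ℕP.m+[n∸m]≡n i≤m)) | fromℕ-+ i (m ∸ i) =
    +-*-Solver.solve 4 (λ x y u v → (x :+ y) :* (u :* v) := (x :* u) :* v :+ u :* (y :* v)) refl
      (fromℕ i) (fromℕ (m ∸ i)) (a i) (b (m ∸ i))
    where open +-*-Solver

SolvesExpODE : ℚ → PS → Set
SolvesExpODE c F = Θ F ≈ (constₚ c ⊛ Tₚ) ⊛ F

expODE-coeff : ∀ c F m → ((constₚ c ⊛ Tₚ) ⊛ F) (suc m) ≡ c * F m
expODE-coeff c F m =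
  trans (⊛-assoc (constₚ c) Tₚ F (suc m))
    (trans (const⊛-coeff c (Tₚ ⊛ F) (suc m)) (cong (c *_) (T⊛-coeff-suc F m)))

expODE-unique : ∀ c F G → F 0 ≡ G 0 → SolvesExpODE c F → SolvesExpODE c G → F ≈ G
expODE-unique c F G F₀≡G₀ odeF odeG zero = F₀≡G₀
expODE-unique c F G F₀≡G₀ odeF odeG (suc m) = *-cancelˡ (fromℕ (suc m)) {{fromℕ-nonZero (suc m)}} (begin
  fromℕ (suc m) * F (suc m)   ≡⟨ trans (odeF (suc m)) (expODE-coeff c F m) ⟩
  c * F m                     ≡⟨ cong (c *_) (expODE-unique c F G F₀≡G₀ odeF odeG m) ⟩
  c * G m                     ≡⟨ sym (trans (odeG (suc m)) (expODE-coeff c G m)) ⟩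
  fromℕ (suc m) * G (suc m)   ∎)
  where open ≡-Reasoning

exp-solvesODE : ∀ c → SolvesExpODE c (scaleₚ c expₚ)
exp-solvesODE c zero =
  trans (*-zeroˡ (1ℚ * 1ℚ))
    (sym (trans (⊛-assoc (constₚ c) Tₚ (scaleₚ c expₚ) 0) (*-zeroʳ c)))
exp-solvesODE c (suc m) = trans coefficient (sym (expODE-coeff c (scaleₚ c expₚ) m))
  where
  r = fromℕ (suc m)
  r⁻¹ = ℤ.+ 1 ÷ suc m
  coefficient : r * ((c * powℚ c m) * (expₚ m * r⁻¹)) ≡ c * (powℚ c m * expₚ m)
  coefficient =
    trans (+-*-Solver.solve 5 (λ r c p e s → r :* ((c :* p) :* (e :* s)) := (c :* (p :* e)) :* (r :* s)) refl
            r c (powℚ c m) (expₚ m) r⁻¹)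
      (trans (cong ((c * (powℚ c m * expₚ m)) *_) (fromℕ-inverse m)) (*-identityʳ _))
    where open +-*-Solver

-- e^{cT} e^{dT} = e^{(c+d)T}: both sides solve the equation for c + d.
exp-+ : ∀ c d → scaleₚ c expₚ ⊛ scaleₚ d expₚ ≈ scaleₚ (c + d) expₚ
exp-+ c d = expODE-unique (c + d) (e^c ⊛ e^d) (scaleₚ (c + d) expₚ) refl product-solves (exp-solvesODE (c + d))
  where
  open ≈-Reasoning
  open PS-Solver
  e^c = scaleₚ c expₚ
  e^d = scaleₚ d expₚ
  product-solves : SolvesExpODE (c + d) (e^c ⊛ e^d)
  product-solves = begin
    Θ (e^c ⊛ e^d)
      ≈⟨ Θ-⊛ e^c e^d ⟩
    Θ e^c ⊛ e^d ⊕ e^c ⊛ Θ e^d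
      ≈⟨ ⊕-cong (⊛-cong (exp-solvesODE c) (≈-refl {e^d})) (⊛-cong (≈-refl {e^c}) (exp-solvesODE d)) ⟩
    (constₚ c ⊛ Tₚ ⊛ e^c) ⊛ e^d ⊕ e^c ⊛ (constₚ d ⊛ Tₚ ⊛ e^d)
      ≈⟨ solve 5 (λ C D T x y → (C :* T :* x) :* y :+ x :* (D :* T :* y) := ((C :+ D) :* T) :* (x :* y))
           ≈-refl (constₚ c) (constₚ d) Tₚ e^c e^d ⟩
    ((constₚ c ⊕ constₚ d) ⊛ Tₚ) ⊛ (e^c ⊛ e^d)
      ≈⟨ ⊛-cong (⊛-cong (≈-sym (const-+ c d)) (≈-refl {Tₚ})) (≈-refl {e^c ⊛ e^d}) ⟩
    (constₚ (c + d) ⊛ Tₚ) ⊛ (e^c ⊛ e^d) ∎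

exp-pow : ∀ k → powₚ expₚ k ≈ scaleₚ (fromℕ k) expₚ
exp-pow zero zero = refl
exp-pow zero (suc i) = sym (trans (cong (_* expₚ (suc i)) (*-zeroˡ (powℚ 0ℚ i))) (*-zeroˡ (expₚ (suc i))))
exp-pow (suc k) = begin
  expₚ ⊛ powₚ expₚ k                             ≈⟨ ⊛-cong (≈-sym (scale-one expₚ)) (exp-pow k) ⟩
  scaleₚ 1ℚ expₚ ⊛ scaleₚ (fromℕ k) expₚ          ≈⟨ exp-+ 1ℚ (fromℕ k) ⟩
  scaleₚ (1ℚ + fromℕ k) expₚ                     ≈⟨ scale-congˡ expₚ (sym (fromℕ-suc k)) ⟩
  scaleₚ (fromℕ (suc k)) expₚ                    ∎
  where open ≈-Reasoning

invTab-below : ∀ a n m → m ≤ n → invTab a (suc n) m ≡ invTab a n m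
invTab-below a n m m≤n with m ≤? n
... | yes _ = refl
... | no m≰n = ⊥-elim (m≰n m≤n)

invTab-top : ∀ a n → invTab a (suc n) (suc n) ≡ - sumTo n (λ i → a (suc i) * invTab a n (n ∸ i))
invTab-top a n with suc n ≤? n
... | yes n<n = ⊥-elim (ℕP.<-irrefl refl n<n)
... | no _ = refl

invTab-stable : ∀ a n m → m ≤ n → invTab a n m ≡ inv1ₚ a m
invTab-stable a zero .zero z≤n = refl
invTab-stable a (suc n) m m≤1+n with ℕP.m≤n⇒m<n∨m≡n m≤1+n
... | inj₁ (s≤s m≤n) = trans (invTab-below a n m m≤n) (invTab-stable a n m m≤n)
... | inj₂ refl = refl

inv1-inverse : ∀ a → a 0 ≡ 1ℚ → a ⊛ inv1ₚ a ≈ oneₚ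
inv1-inverse a a₀≡1 zero rewrite a₀≡1 = refl
inv1-inverse a a₀≡1 (suc m) = begin
  sumTo (suc m) (λ i → a i * c (suc m ∸ i))
    ≡⟨ sumTo-suc m (λ i → a i * c (suc m ∸ i)) ⟩
  a 0 * c (suc m) + S
    ≡⟨ cong₂ (λ x y → x * y + S) a₀≡1 (invTab-top a m) ⟩
  1ℚ * (- sumTo m (λ i → a (suc i) * invTab a m (m ∸ i))) + S
    ≡⟨ cong (λ x → 1ℚ * (- x) + S) (sumTo-cong m stable) ⟩
  1ℚ * (- S) + S
    ≡⟨ cong (_+ S) (*-identityˡ (- S)) ⟩
  - S + S
    ≡⟨ +-inverseˡ S ⟩
  0ℚ ∎
  where
  open ≡-Reasoning
  c = inv1ₚ a
  S = sumTo m (λ i → a (suc i) * c (m ∸ i))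
  stable : ∀ i → i ≤ m → a (suc i) * invTab a m (m ∸ i) ≡ a (suc i) * c (m ∸ i)
  stable i _ = cong (a (suc i) *_) (invTab-stable a m (m ∸ i) (ℕP.m∸n≤m m i))

-- B(cT)·(e^{cT} - 1) = cT, obtained from B(T)·(e^T - 1)/T = 1 by substituting cT.
B-relation : ∀ c → scaleₚ c Bₚ ⊛ (scaleₚ c expₚ ⊕ negₚ oneₚ) ≈ constₚ c ⊛ Tₚ
B-relation c = begin
  B′ ⊛ (scaleₚ c expₚ ⊕ negₚ oneₚ)
    ≈⟨ ⊛-cong (≈-refl {B′}) (⊕-cong scaled-exp (≈-refl {negₚ oneₚ})) ⟩
  B′ ⊛ (oneₚ ⊕ (constₚ c ⊛ Tₚ) ⊛ S′ ⊕ negₚ oneₚ)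
    ≈⟨ solve 4 (λ B C T s → B :* (con 1ℚ :+ (C :* T) :* s :+ :- con 1ℚ) := (C :* T) :* (B :* s))
         ≈-refl B′ (constₚ c) Tₚ S′ ⟩
  (constₚ c ⊛ Tₚ) ⊛ (B′ ⊛ S′)
    ≈⟨ ⊛-cong (≈-refl {constₚ c ⊛ Tₚ}) scaled-inverse ⟩
  (constₚ c ⊛ Tₚ) ⊛ oneₚ
    ≈⟨ ⊛-identityʳ (constₚ c ⊛ Tₚ) ⟩
  constₚ c ⊛ Tₚ ∎
  where
  open ≈-Reasoning
  open PS-Solver
  B′ = scaleₚ c Bₚ
  S′ = scaleₚ c expShiftₚ
  scaled-exp : scaleₚ c expₚ ≈ oneₚ ⊕ (constₚ c ⊛ Tₚ) ⊛ S′
  scaled-exp = begin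
    scaleₚ c expₚ                              ≈⟨ scale-cong c (split-constant-term expₚ) ⟩
    scaleₚ c (oneₚ ⊕ Tₚ ⊛ expShiftₚ)           ≈⟨ scale-⊕ c oneₚ (Tₚ ⊛ expShiftₚ) ⟩
    scaleₚ c oneₚ ⊕ scaleₚ c (Tₚ ⊛ expShiftₚ)  ≈⟨ ⊕-cong (scale-const c 1ℚ) (scale-⊛ c Tₚ expShiftₚ) ⟩
    oneₚ ⊕ scaleₚ c Tₚ ⊛ S′                     ≈⟨ ⊕-cong (≈-refl {oneₚ}) (⊛-cong (scale-T c) (≈-refl {S′})) ⟩
    oneₚ ⊕ (constₚ c ⊛ Tₚ) ⊛ S′                 ∎
  scaled-inverse : B′ ⊛ S′ ≈ oneₚ
  scaled-inverse = begin
    B′ ⊛ S′                        ≈⟨ ≈-sym (scale-⊛ c Bₚ expShiftₚ) ⟩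
    scaleₚ c (Bₚ ⊛ expShiftₚ)      ≈⟨ scale-cong c (≈-trans (⊛-comm Bₚ expShiftₚ) (inv1-inverse expShiftₚ refl)) ⟩
    scaleₚ c oneₚ                  ≈⟨ scale-const c 1ℚ ⟩
    oneₚ                           ∎

Poly : Set
Poly = List ℚ

evalPoly : Poly → PS → PS
evalPoly [] P = zeroₚ
evalPoly (c ∷ cs) P = constₚ c ⊕ P ⊛ evalPoly cs P

infixl 6 _+ᴾ_
infixl 7 _*ᴾ_

_+ᴾ_ : Poly → Poly → Poly
[] +ᴾ q = q
(a ∷ p) +ᴾ [] = a ∷ p
(a ∷ p) +ᴾ (b ∷ q) = (a + b) ∷ (p +ᴾ q)

scaleᴾ : ℚ → Poly → Poly
scaleᴾ c [] = []
scaleᴾ c (a ∷ p) = (c * a) ∷ scaleᴾ c p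

_*ᴾ_ : Poly → Poly → Poly
[] *ᴾ q = []
(a ∷ p) *ᴾ q = scaleᴾ a q +ᴾ (0ℚ ∷ (p *ᴾ q))

powᴾ : Poly → ℕ → Poly
powᴾ p zero = 1ℚ ∷ []
powᴾ p (suc k) = p *ᴾ powᴾ p k

zero≈const0 : zeroₚ ≈ constₚ 0ℚ
zero≈const0 zero = refl
zero≈const0 (suc m) = refl

eval-+ : ∀ p q P → evalPoly (p +ᴾ q) P ≈ evalPoly p P ⊕ evalPoly q P
eval-+ [] q P = ≈-trans (solve 1 (λ x → x := con 0ℚ :+ x) ≈-refl (evalPoly q P)) (⊕-cong (≈-sym zero≈const0) (≈-refl {evalPoly q P}))
  where open PS-Solver
eval-+ (a ∷ p) [] P = ≈-trans (solve 1 (λ x → x := x :+ con 0ℚ) ≈-refl (evalPoly (a ∷ p) P)) (⊕-cong (≈-refl {evalPoly (a ∷ p) P}) (≈-sym zero≈const0))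
  where open PS-Solver
eval-+ (a ∷ p) (b ∷ q) P = ≈-trans (⊕-cong (const-+ a b) (⊛-cong (≈-refl {P}) (eval-+ p q P)))
  (solve 5 (λ A B P x y → (A :+ B) :+ P :* (x :+ y) := (A :+ P :* x) :+ (B :+ P :* y)) ≈-refl
    (constₚ a) (constₚ b) P (evalPoly p P) (evalPoly q P))
  where open PS-Solver

eval-scale : ∀ c q P → evalPoly (scaleᴾ c q) P ≈ constₚ c ⊛ evalPoly q P
eval-scale c [] P = ≈-sym (⊛-zeroʳ (constₚ c))
eval-scale c (a ∷ q) P = ≈-trans (⊕-cong (const-* c a) (⊛-cong (≈-refl {P}) (eval-scale c q P)))
  (solve 4 (λ C A P x → C :* A :+ P :* (C :* x) := C :* (A :+ P :* x)) ≈-refl (constₚ c) (constₚ a) P (evalPoly q P))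
  where open PS-Solver

eval-* : ∀ p q P → evalPoly (p *ᴾ q) P ≈ evalPoly p P ⊛ evalPoly q P
eval-* [] q P = ≈-sym (⊛-zeroˡ (evalPoly q P))
eval-* (a ∷ p) q P = begin
  evalPoly (scaleᴾ a q +ᴾ (0ℚ ∷ (p *ᴾ q))) P
    ≈⟨ eval-+ (scaleᴾ a q) (0ℚ ∷ (p *ᴾ q)) P ⟩
  evalPoly (scaleᴾ a q) P ⊕ (constₚ 0ℚ ⊕ P ⊛ evalPoly (p *ᴾ q) P)
    ≈⟨ ⊕-cong (eval-scale a q P) (⊕-cong (≈-refl {constₚ 0ℚ}) (⊛-cong (≈-refl {P}) (eval-* p q P))) ⟩
  constₚ a ⊛ Q ⊕ (constₚ 0ℚ ⊕ P ⊛ (evalPoly p P ⊛ Q))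
    ≈⟨ solve 4 (λ A P x y → A :* y :+ (con 0ℚ :+ P :* (x :* y)) := (A :+ P :* x) :* y) ≈-refl
         (constₚ a) P (evalPoly p P) Q ⟩
  (constₚ a ⊕ P ⊛ evalPoly p P) ⊛ Q ∎
  where
  open ≈-Reasoning
  open PS-Solver
  Q = evalPoly q P

eval-one : ∀ P → evalPoly (1ℚ ∷ []) P ≈ oneₚ
eval-one P = ≈-trans (⊕-cong (≈-refl {oneₚ}) (⊛-zeroʳ P)) (λ m → +-identityʳ (oneₚ m))

eval-pow : ∀ p k P → evalPoly (powᴾ p k) P ≈ powₚ (evalPoly p P) k
eval-pow p zero P = eval-one P
eval-pow p (suc k) P = ≈-trans (eval-* p (powᴾ p k) P) (⊛-cong (≈-refl {evalPoly p P}) (eval-pow p k P))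

evalT-coeff-zero : ∀ c cs → evalPoly (c ∷ cs) Tₚ 0 ≡ c
evalT-coeff-zero c cs = trans (cong (c +_) (T⊛-coeff-zero (evalPoly cs Tₚ))) (+-identityʳ c)

evalT-coeff-suc : ∀ c cs m → evalPoly (c ∷ cs) Tₚ (suc m) ≡ evalPoly cs Tₚ m
evalT-coeff-suc c cs m = trans (cong (0ℚ +_) (T⊛-coeff-suc (evalPoly cs Tₚ) m)) (+-identityˡ _)

evalT-zero⇒zero-coeffs : ∀ p → evalPoly p Tₚ ≈ zeroₚ → All (_≡ 0ℚ) p
evalT-zero⇒zero-coeffs [] _ = []
evalT-zero⇒zero-coeffs (c ∷ cs) vanishes =
  trans (sym (evalT-coeff-zero c cs)) (vanishes 0)
  ∷ evalT-zero⇒zero-coeffs cs (λ m → trans (sym (evalT-coeff-suc c cs m)) (vanishes (suc m)))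

zero-coeffs⇒eval-zero : ∀ {p} → All (_≡ 0ℚ) p → ∀ P → evalPoly p P ≈ zeroₚ
zero-coeffs⇒eval-zero [] P = ≈-refl
zero-coeffs⇒eval-zero {_ ∷ cs} (refl ∷ zs) P = begin
  constₚ 0ℚ ⊕ P ⊛ evalPoly cs P
    ≈⟨ ⊕-cong (≈-sym zero≈const0) (⊛-cong (≈-refl {P}) (zero-coeffs⇒eval-zero zs P)) ⟩
  zeroₚ ⊕ P ⊛ zeroₚ
    ≈⟨ (λ m → trans (+-identityˡ _) (⊛-zeroʳ P m)) ⟩
  zeroₚ ∎
  where open ≈-Reasoning

-- Transfer principle: two polynomials with the same value at T have the same
-- value at every power series P (apply the above to p - q).
transfer : ∀ p q → evalPoly p Tₚ ≈ evalPoly q Tₚ → ∀ P → evalPoly p P ≈ evalPoly q P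
transfer p q agreeAtT P = begin
  evalPoly p P
    ≈⟨ solve 2 (λ x y → x := (x :+ con (- 1ℚ) :* y) :+ y) ≈-refl (evalPoly p P) (evalPoly q P) ⟩
  (evalPoly p P ⊕ constₚ (- 1ℚ) ⊛ evalPoly q P) ⊕ evalPoly q P
    ≈⟨ ⊕-cong (≈-sym (eval-difference P)) (≈-refl {evalPoly q P}) ⟩
  evalPoly difference P ⊕ evalPoly q P
    ≈⟨ ⊕-cong (zero-coeffs⇒eval-zero (evalT-zero⇒zero-coeffs difference differenceAtT) P) (≈-refl {evalPoly q P}) ⟩
  zeroₚ ⊕ evalPoly q P
    ≈⟨ (λ m → +-identityˡ (evalPoly q P m)) ⟩
  evalPoly q P ∎
  where
  open ≈-Reasoning
  open PS-Solver
  difference = p +ᴾ scaleᴾ (- 1ℚ) q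
  eval-difference : ∀ P → evalPoly difference P ≈ evalPoly p P ⊕ constₚ (- 1ℚ) ⊛ evalPoly q P
  eval-difference P = ≈-trans (eval-+ p (scaleᴾ (- 1ℚ) q) P) (⊕-cong (≈-refl {evalPoly p P}) (eval-scale (- 1ℚ) q P))
  differenceAtT : evalPoly difference Tₚ ≈ zeroₚ
  differenceAtT = begin
    evalPoly difference Tₚ                                ≈⟨ eval-difference Tₚ ⟩
    evalPoly p Tₚ ⊕ constₚ (- 1ℚ) ⊛ evalPoly q Tₚ         ≈⟨ ⊕-cong agreeAtT (≈-refl {constₚ (- 1ℚ) ⊛ evalPoly q Tₚ}) ⟩
    evalPoly q Tₚ ⊕ constₚ (- 1ℚ) ⊛ evalPoly q Tₚ         ≈⟨ solve 1 (λ y → y :+ con (- 1ℚ) :* y := con 0ℚ) ≈-refl (evalPoly q Tₚ) ⟩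
    constₚ 0ℚ                                             ≈⟨ ≈-sym zero≈const0 ⟩
    zeroₚ                                                 ∎

evalAt≈evalPoly : ∀ {m} (v : Vec ℚ m) P → evalAtₚ v P ≈ evalPoly (toList v) P
evalAt≈evalPoly []ᵥ P = ≈-refl
evalAt≈evalPoly (c ∷ᵥ cs) P = ⊕-cong (≈-refl {constₚ c}) (⊛-cong (≈-refl {P}) (evalAt≈evalPoly cs P))

poly≈evalT : ∀ {m} (v : Vec ℚ m) → polyₚ v ≈ evalPoly (toList v) Tₚ
poly≈evalT []ᵥ i = refl
poly≈evalT (c ∷ᵥ cs) zero = sym (evalT-coeff-zero c (toList cs))
poly≈evalT (c ∷ᵥ cs) (suc i) = trans (poly≈evalT cs i) (sym (evalT-coeff-suc c (toList cs) i))

cyclo-inside : ∀ N i → suc i ≤ N → cycloSumₚ N i ≡ 1ℚ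
cyclo-inside N i i<N with suc i ≤? N
... | yes _ = refl
... | no i≮N = ⊥-elim (i≮N i<N)

cyclo-outside : ∀ N i → ¬ (suc i ≤ N) → cycloSumₚ N i ≡ 0ℚ
cyclo-outside N i i≮N with suc i ≤? N
... | yes i<N = ⊥-elim (i≮N i<N)
... | no _ = refl

cyclo-shift : ∀ N i → cycloSumₚ (suc N) (suc i) ≡ cycloSumₚ N i
cyclo-shift N i with suc i ≤? N
... | yes i<N = cyclo-inside (suc N) (suc i) (s≤s i<N)
... | no i≮N = cyclo-outside (suc N) (suc i) (λ { (s≤s i<N) → i≮N i<N })

cyclo-step : ∀ N → cycloSumₚ (suc N) ≈ oneₚ ⊕ Tₚ ⊛ cycloSumₚ N
cyclo-step N = ≈-trans (split-constant-term (cycloSumₚ (suc N)))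
  (⊕-cong (λ i → cong (λ x → constₚ x i) (cyclo-inside (suc N) 0 (s≤s z≤n)))
          (⊛-cong (≈-refl {Tₚ}) (cyclo-shift N)))

cycloPoly : ℕ → Poly
cycloPoly N = replicate N 1ℚ

cyclo≈evalT : ∀ N → cycloSumₚ N ≈ evalPoly (cycloPoly N) Tₚ
cyclo≈evalT zero i = cyclo-outside 0 i (λ ())
cyclo≈evalT (suc N) = ≈-trans (cyclo-step N) (⊕-cong (≈-refl {oneₚ}) (⊛-cong (≈-refl {Tₚ}) (cyclo≈evalT N)))

xMinus1Poly : Poly
xMinus1Poly = - 1ℚ ∷ 1ℚ ∷ []

xMinus1≈evalT : xMinus1ₚ ≈ evalPoly xMinus1Poly Tₚ
xMinus1≈evalT zero = sym (evalT-coeff-zero (- 1ℚ) (1ℚ ∷ []))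
xMinus1≈evalT (suc zero) = trans (sym (evalT-coeff-zero 1ℚ [])) (sym (evalT-coeff-suc (- 1ℚ) (1ℚ ∷ []) 0))
xMinus1≈evalT (suc (suc m)) = sym (trans (evalT-coeff-suc (- 1ℚ) (1ℚ ∷ []) (suc m)) (evalT-coeff-suc 1ℚ [] m))

eval-xMinus1 : ∀ P → evalPoly xMinus1Poly P ≈ P ⊕ negₚ oneₚ
eval-xMinus1 P = ≈-trans (⊕-cong (≈-refl {constₚ (- 1ℚ)}) (⊛-cong (≈-refl {P}) (eval-one P)))
  (solve 1 (λ P → con (- 1ℚ) :+ P :* con 1ℚ := P :+ :- con 1ℚ) ≈-refl P)
  where open PS-Solver

geometric-sum : ∀ N P → (P ⊕ negₚ oneₚ) ⊛ evalPoly (cycloPoly N) P ≈ powₚ P N ⊕ negₚ oneₚ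
geometric-sum zero P = ≈-trans (⊛-zeroʳ (P ⊕ negₚ oneₚ)) (λ { zero → sym (+-inverseʳ 1ℚ) ; (suc m) → refl })
geometric-sum (suc N) P = begin
  (P ⊕ negₚ oneₚ) ⊛ (oneₚ ⊕ P ⊛ C)
    ≈⟨ solve 2 (λ P c → (P :+ :- con 1ℚ) :* (con 1ℚ :+ P :* c) := (P :+ :- con 1ℚ) :+ P :* ((P :+ :- con 1ℚ) :* c)) ≈-refl P C ⟩
  (P ⊕ negₚ oneₚ) ⊕ P ⊛ ((P ⊕ negₚ oneₚ) ⊛ C)
    ≈⟨ ⊕-cong (≈-refl {P ⊕ negₚ oneₚ}) (⊛-cong (≈-refl {P}) (geometric-sum N P)) ⟩
  (P ⊕ negₚ oneₚ) ⊕ P ⊛ (powₚ P N ⊕ negₚ oneₚ)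
    ≈⟨ solve 2 (λ P Q → (P :+ :- con 1ℚ) :+ P :* (Q :+ :- con 1ℚ) := P :* Q :+ :- con 1ℚ) ≈-refl P (powₚ P N) ⟩
  P ⊛ powₚ P N ⊕ negₚ oneₚ ∎
  where
  open ≈-Reasoning
  open PS-Solver
  C = evalPoly (cycloPoly N) P

partialFraction-at : ∀ k N (h : Vec ℚ k) (f : Vec ℚ (N ∸ 1)) → IsPartialFraction k N h f → ∀ P →
  evalAtₚ h P ⊛ evalPoly (cycloPoly N) P ⊕ evalAtₚ f P ⊛ powₚ (P ⊕ negₚ oneₚ) k ≈ oneₚ
partialFraction-at k N h f pf P = begin
  evalAtₚ h P ⊛ evalPoly C P ⊕ evalAtₚ f P ⊛ powₚ (P ⊕ negₚ oneₚ) k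
    ≈⟨ ⊕-cong (⊛-cong (evalAt≈evalPoly h P) (≈-refl {evalPoly C P}))
              (⊛-cong (evalAt≈evalPoly f P) (pow-cong k (≈-sym (eval-xMinus1 P)))) ⟩
  evalPoly H P ⊛ evalPoly C P ⊕ evalPoly F P ⊛ powₚ (evalPoly xMinus1Poly P) k
    ≈⟨ ≈-sym (eval-lhs P) ⟩
  evalPoly lhs P
    ≈⟨ transfer lhs (1ℚ ∷ []) lhsAtT P ⟩
  evalPoly (1ℚ ∷ []) P
    ≈⟨ eval-one P ⟩
  oneₚ ∎
  where
  open ≈-Reasoning
  H = toList h
  F = toList f
  C = cycloPoly N
  lhs = H *ᴾ C +ᴾ F *ᴾ powᴾ xMinus1Poly k
  eval-lhs : ∀ P → evalPoly lhs P ≈ evalPoly H P ⊛ evalPoly C P ⊕ evalPoly F P ⊛ powₚ (evalPoly xMinus1Poly P) k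
  eval-lhs P = ≈-trans (eval-+ (H *ᴾ C) (F *ᴾ powᴾ xMinus1Poly k) P)
    (⊕-cong (eval-* H C P) (≈-trans (eval-* F (powᴾ xMinus1Poly k) P) (⊛-cong (≈-refl {evalPoly F P}) (eval-pow xMinus1Poly k P))))
  lhsAtT : evalPoly lhs Tₚ ≈ evalPoly (1ℚ ∷ []) Tₚ
  lhsAtT = begin
    evalPoly lhs Tₚ
      ≈⟨ eval-lhs Tₚ ⟩
    evalPoly H Tₚ ⊛ evalPoly C Tₚ ⊕ evalPoly F Tₚ ⊛ powₚ (evalPoly xMinus1Poly Tₚ) k
      ≈⟨ ⊕-cong (⊛-cong (≈-sym (poly≈evalT h)) (≈-sym (cyclo≈evalT N)))
                (⊛-cong (≈-sym (poly≈evalT f)) (pow-cong k (≈-sym xMinus1≈evalT))) ⟩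
    polyₚ h ⊛ cycloSumₚ N ⊕ polyₚ f ⊛ powₚ xMinus1ₚ k
      ≈⟨ pf ⟩
    oneₚ
      ≈⟨ ≈-sym (eval-one Tₚ) ⟩
    evalPoly (1ℚ ∷ []) Tₚ ∎

-- The identity. Below, for ℓ ≥ 1: E = e^{ℓT} (as the power (e^T)^ℓ),
-- L = B(ℓT), and X - 1 is evaluated at E.

module _ (ℓ : ℕ) where

  E : PS
  E = powₚ expₚ ℓ

  L : PS
  L = scaleₚ (fromℕ ℓ) Bₚ

  E-1 : PS
  E-1 = E ⊕ negₚ oneₚ

  L⊛E-1 : L ⊛ E-1 ≈ constₚ (fromℕ ℓ) ⊛ Tₚ
  L⊛E-1 = ≈-trans (⊛-cong (≈-refl {L}) (⊕-cong (exp-pow ℓ) (≈-refl {negₚ oneₚ}))) (B-relation (fromℕ ℓ))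

  monomial-factorisation : ∀ k → monoₚ k (fromℕ (ℓ ^ k)) ≈ powₚ L k ⊛ powₚ E-1 k
  monomial-factorisation k = begin
    monoₚ k (fromℕ (ℓ ^ k))
      ≈⟨ mono≈const⊛T^k k (fromℕ (ℓ ^ k)) ⟩
    constₚ (fromℕ (ℓ ^ k)) ⊛ powₚ Tₚ k
      ≈⟨ ⊛-cong (λ i → cong (λ x → constₚ x i) (sym (powℚ-fromℕ ℓ k))) (≈-refl {powₚ Tₚ k}) ⟩
    constₚ (powℚ (fromℕ ℓ) k) ⊛ powₚ Tₚ k
      ≈⟨ ⊛-cong (const-pow (fromℕ ℓ) k) (≈-refl {powₚ Tₚ k}) ⟩
    powₚ (constₚ (fromℕ ℓ)) k ⊛ powₚ Tₚ k
      ≈⟨ ≈-sym (pow-⊛ (constₚ (fromℕ ℓ)) Tₚ k) ⟩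
    powₚ (constₚ (fromℕ ℓ) ⊛ Tₚ) k
      ≈⟨ pow-cong k (≈-sym L⊛E-1) ⟩
    powₚ (L ⊛ E-1) k
      ≈⟨ pow-⊛ L E-1 k ⟩
    powₚ L k ⊛ powₚ E-1 k ∎
    where open ≈-Reasoning

  -- (b) B(nT)·(1 + E + … + E^{N-1}) = N·B(ℓT) when n = ℓN: multiplied by ℓT,
  -- both sides become nT·B(ℓT), using (a), the geometric sum and E^N = e^{nT}.
  B-cyclo : .{{_ : NonZero ℓ}} → ∀ N n → ℓ ℕ.* N ≡ n →
    scaleₚ (fromℕ n) Bₚ ⊛ evalPoly (cycloPoly N) E ≈ constₚ (fromℕ N) ⊛ L
  B-cyclo N n ℓN≡n = const-cancel (fromℕ ℓ) {{fromℕ-nonZero ℓ}} (T-cancel (begin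
    Tₚ ⊛ (cℓ ⊛ (M ⊛ C))
      ≈⟨ solve 4 (λ T c M C → T :* (c :* (M :* C)) := (M :* C) :* (c :* T)) ≈-refl Tₚ cℓ M C ⟩
    (M ⊛ C) ⊛ (cℓ ⊛ Tₚ)
      ≈⟨ ⊛-cong (≈-refl {M ⊛ C}) (≈-sym L⊛E-1) ⟩
    (M ⊛ C) ⊛ (L ⊛ E-1)
      ≈⟨ solve 4 (λ M C L Y → (M :* C) :* (L :* Y) := L :* (M :* (Y :* C))) ≈-refl M C L E-1 ⟩
    L ⊛ (M ⊛ (E-1 ⊛ C))
      ≈⟨ ⊛-cong (≈-refl {L}) (⊛-cong (≈-refl {M}) (geometric-sum N E)) ⟩
    L ⊛ (M ⊛ (powₚ E N ⊕ negₚ oneₚ))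
      ≈⟨ ⊛-cong (≈-refl {L}) (⊛-cong (≈-refl {M}) (⊕-cong E^N (≈-refl {negₚ oneₚ}))) ⟩
    L ⊛ (M ⊛ (scaleₚ (fromℕ n) expₚ ⊕ negₚ oneₚ))
      ≈⟨ ⊛-cong (≈-refl {L}) (B-relation (fromℕ n)) ⟩
    L ⊛ (constₚ (fromℕ n) ⊛ Tₚ)
      ≈⟨ ⊛-cong (≈-refl {L}) (⊛-cong cn≈cℓ⊛cN (≈-refl {Tₚ})) ⟩
    L ⊛ ((cℓ ⊛ cN) ⊛ Tₚ)
      ≈⟨ solve 4 (λ L c d T → L :* ((c :* d) :* T) := T :* (c :* (d :* L))) ≈-refl L cℓ cN Tₚ ⟩
    Tₚ ⊛ (cℓ ⊛ (cN ⊛ L)) ∎))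
    where
    open ≈-Reasoning
    open PS-Solver
    M = scaleₚ (fromℕ n) Bₚ
    C = evalPoly (cycloPoly N) E
    cℓ = constₚ (fromℕ ℓ)
    cN = constₚ (fromℕ N)
    E^N : powₚ E N ≈ scaleₚ (fromℕ n) expₚ
    E^N = ≈-trans (≈-sym (pow-* expₚ ℓ N)) (≈-trans (exp-pow (ℓ ℕ.* N)) (scale-congˡ expₚ (cong fromℕ ℓN≡n)))
    cn≈cℓ⊛cN : constₚ (fromℕ n) ≈ cℓ ⊛ cN
    cn≈cℓ⊛cN = ≈-trans (λ i → cong (λ x → constₚ x i) (trans (cong fromℕ (sym ℓN≡n)) (fromℕ-* ℓ N)))
                       (const-* (fromℕ ℓ) (fromℕ N))

  bernoulli-partialFraction : .{{_ : NonZero ℓ}} → ∀ k N n → ℓ ℕ.* N ≡ n →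
    (h : Vec ℚ k) (f : Vec ℚ (N ∸ 1)) → IsPartialFraction k N h f →
    powₚ L k ⊛ scaleₚ (fromℕ n) Bₚ
      ≈ monoₚ k (fromℕ (ℓ ^ k)) ⊛ scaleₚ (fromℕ n) Bₚ ⊛ evalAtₚ f E
        ⊕ constₚ (fromℕ N) ⊛ powₚ L (suc k) ⊛ evalAtₚ h E
  bernoulli-partialFraction k N n ℓN≡n h f pf = begin
    Lᵏ ⊛ M
      ≈⟨ ≈-sym (⊛-identityʳ (Lᵏ ⊛ M)) ⟩
    (Lᵏ ⊛ M) ⊛ oneₚ
      ≈⟨ ⊛-cong (≈-refl {Lᵏ ⊛ M}) (≈-sym (partialFraction-at k N h f pf E)) ⟩
    (Lᵏ ⊛ M) ⊛ (h′ ⊛ C ⊕ f′ ⊛ Yᵏ)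
      ≈⟨ solve 6 (λ Lk M h C f Yk → (Lk :* M) :* (h :* C :+ f :* Yk) := (Lk :* h) :* (M :* C) :+ (Lk :* Yk) :* M :* f)
           ≈-refl Lᵏ M h′ C f′ Yᵏ ⟩
    (Lᵏ ⊛ h′) ⊛ (M ⊛ C) ⊕ (Lᵏ ⊛ Yᵏ) ⊛ M ⊛ f′
      ≈⟨ ⊕-cong (⊛-cong (≈-refl {Lᵏ ⊛ h′}) (B-cyclo N n ℓN≡n))
                (⊛-cong (⊛-cong (≈-sym (monomial-factorisation k)) (≈-refl {M})) (≈-refl {f′})) ⟩
    (Lᵏ ⊛ h′) ⊛ (cN ⊛ L) ⊕ mono ⊛ M ⊛ f′
      ≈⟨ solve 6 (λ Lk h cN L mo f → (Lk :* h) :* (cN :* L) :+ mo :* f := mo :* f :+ cN :* (L :* Lk) :* h)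
           ≈-refl Lᵏ h′ cN L (mono ⊛ M) f′ ⟩
    mono ⊛ M ⊛ f′ ⊕ cN ⊛ (L ⊛ Lᵏ) ⊛ h′ ∎
    where
    open ≈-Reasoning
    open PS-Solver
    Lᵏ = powₚ L k
    M = scaleₚ (fromℕ n) Bₚ
    Yᵏ = powₚ E-1 k
    h′ = evalAtₚ h E
    f′ = evalAtₚ f E
    C = evalPoly (cycloPoly N) E
    cN = constₚ (fromℕ N)
    mono = monoₚ k (fromℕ (ℓ ^ k))

DegreeBelow : ℕ → PS → Set
DegreeBelow d a = ∀ i → d ≤ i → a i ≡ 0ℚ

degree-weaken : ∀ {d e a} → d ≤ e → DegreeBelow d a → DegreeBelow e a
degree-weaken d≤e deg i e≤i = deg i (ℕP.≤-trans d≤e e≤i)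

degree-⊕ : ∀ {d a b} → DegreeBelow d a → DegreeBelow d b → DegreeBelow d (a ⊕ b)
degree-⊕ degA degB i d≤i rewrite degA i d≤i | degB i d≤i = refl

degree-neg : ∀ {d a} → DegreeBelow d a → DegreeBelow d (negₚ a)
degree-neg deg i d≤i rewrite deg i d≤i = refl

degree-const : ∀ c → DegreeBelow 1 (constₚ c)
degree-const c (suc i) _ = refl

degree-zero : ∀ d → DegreeBelow d zeroₚ
degree-zero d i _ = refl

degree-const⊛ : ∀ {d a} c → DegreeBelow d a → DegreeBelow d (constₚ c ⊛ a)
degree-const⊛ {a = a} c deg i d≤i = trans (const⊛-coeff c a i) (trans (cong (c *_) (deg i d≤i)) (*-zeroʳ c))

degree-T⊛ : ∀ {d a} → DegreeBelow d a → DegreeBelow (suc d) (Tₚ ⊛ a)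
degree-T⊛ {a = a} deg (suc i) (s≤s d≤i) = trans (T⊛-coeff-suc a i) (deg i d≤i)

degree-⊛ : ∀ {d e a b} → DegreeBelow (suc d) a → DegreeBelow (suc e) b → DegreeBelow (suc (d ℕ.+ e)) (a ⊛ b)
degree-⊛ {d} {e} {a} {b} degA degB i bound = sumTo-zero i _ term-vanishes
  where
  index-bound : ∀ {j} → j ≤ d → suc e ≤ i ∸ j
  index-bound {j} j≤d = begin
    suc e                 ≡⟨ sym (trans (cong (_∸ d) (sym (ℕP.+-suc d e))) (ℕP.m+n∸m≡n d (suc e))) ⟩
    suc (d ℕ.+ e) ∸ d     ≤⟨ ℕP.∸-monoˡ-≤ d bound ⟩
    i ∸ d                 ≤⟨ ℕP.∸-monoʳ-≤ i j≤d ⟩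
    i ∸ j                 ∎
    where open ℕP.≤-Reasoning
  term-vanishes : ∀ j → j ≤ i → a j * b (i ∸ j) ≡ 0ℚ
  term-vanishes j _ with j ≤? d
  ... | yes j≤d = trans (cong (a j *_) (degB (i ∸ j) (index-bound j≤d))) (*-zeroʳ (a j))
  ... | no j≰d = trans (cong (_* b (i ∸ j)) (degA j (ℕP.≰⇒> j≰d))) (*-zeroˡ (b (i ∸ j)))

coeffVec : (d : ℕ) → PS → Vec ℚ d
coeffVec zero a = []ᵥ
coeffVec (suc d) a = a 0 ∷ᵥ coeffVec d (a ∘ suc)

poly-coeffVec : ∀ d a → DegreeBelow d a → polyₚ (coeffVec d a) ≈ a
poly-coeffVec zero a deg i = sym (deg i z≤n)
poly-coeffVec (suc d) a deg zero = refl
poly-coeffVec (suc d) a deg (suc i) = poly-coeffVec d (a ∘ suc) (λ j d≤j → deg (suc j) (s≤s d≤j)) i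

Y : PS
Y = xMinus1ₚ

T≈Y+1 : Tₚ ≈ Y ⊕ oneₚ
T≈Y+1 zero = refl
T≈Y+1 (suc zero) = refl
T≈Y+1 (suc (suc m)) = refl

divide-by-Y : ∀ d p → DegreeBelow (suc d) p → Σ[ v ∈ ℚ ] Σ[ q ∈ PS ] DegreeBelow d q × (p ≈ constₚ v ⊕ Y ⊛ q)
divide-by-Y zero p deg = p 0 , zeroₚ , degree-zero 0 , p≈p₀
  where
  p≈p₀ : p ≈ constₚ (p 0) ⊕ Y ⊛ zeroₚ
  p≈p₀ zero = sym (trans (cong (p 0 +_) (⊛-zeroʳ Y 0)) (+-identityʳ (p 0)))
  p≈p₀ (suc m) = trans (deg (suc m) (s≤s z≤n)) (sym (trans (cong (0ℚ +_) (⊛-zeroʳ Y (suc m))) (+-identityˡ 0ℚ)))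
divide-by-Y (suc d) p deg with divide-by-Y d (p ∘ suc) (λ i d≤i → deg (suc i) (s≤s d≤i))
... | v , q , degQ , p′≈ =
  p 0 + v , constₚ v ⊕ Tₚ ⊛ q ,
  degree-⊕ (degree-weaken (s≤s z≤n) (degree-const v)) (degree-T⊛ degQ) , p≈
  where
  open ≈-Reasoning
  open PS-Solver
  p≈ : p ≈ constₚ (p 0 + v) ⊕ Y ⊛ (constₚ v ⊕ Tₚ ⊛ q)
  p≈ = begin
    p
      ≈⟨ split-constant-term p ⟩
    constₚ (p 0) ⊕ Tₚ ⊛ (p ∘ suc)
      ≈⟨ ⊕-cong (≈-refl {constₚ (p 0)}) (⊛-cong T≈Y+1 p′≈) ⟩
    constₚ (p 0) ⊕ (Y ⊕ oneₚ) ⊛ (constₚ v ⊕ Y ⊛ q)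
      ≈⟨ solve 4 (λ a b Y q → a :+ (Y :+ con 1ℚ) :* (b :+ Y :* q) := (a :+ b) :+ Y :* (b :+ (Y :+ con 1ℚ) :* q))
           ≈-refl (constₚ (p 0)) (constₚ v) Y q ⟩
    (constₚ (p 0) ⊕ constₚ v) ⊕ Y ⊛ (constₚ v ⊕ (Y ⊕ oneₚ) ⊛ q)
      ≈⟨ ⊕-cong (≈-sym (const-+ (p 0) v)) (⊛-cong (≈-refl {Y}) (⊕-cong (≈-refl {constₚ v}) (⊛-cong (≈-sym T≈Y+1) (≈-refl {q})))) ⟩
    constₚ (p 0 + v) ⊕ Y ⊛ (constₚ v ⊕ Tₚ ⊛ q) ∎

cyclo-at-1 : ∀ M → Σ[ D ∈ PS ] DegreeBelow M D × (cycloSumₚ (suc M) ≈ constₚ (fromℕ (suc M)) ⊕ Y ⊛ D)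
cyclo-at-1 zero = zeroₚ , degree-zero 0 , C₁≈
  where
  C₁≈ : cycloSumₚ 1 ≈ constₚ (fromℕ 1) ⊕ Y ⊛ zeroₚ
  C₁≈ zero = trans (cyclo-inside 1 0 (s≤s z≤n)) (sym (trans (cong (1ℚ +_) (⊛-zeroʳ Y 0)) (+-identityʳ 1ℚ)))
  C₁≈ (suc m) = trans (cyclo-outside 1 (suc m) (λ { (s≤s ()) })) (sym (trans (cong (0ℚ +_) (⊛-zeroʳ Y (suc m))) (+-identityˡ 0ℚ)))
cyclo-at-1 (suc M) with cyclo-at-1 M
... | D , degD , C≈ =
  constₚ K ⊕ Tₚ ⊛ D , degree-⊕ (degree-weaken (s≤s z≤n) (degree-const K)) (degree-T⊛ degD) , C′≈
  where
  open ≈-Reasoning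
  open PS-Solver
  K = fromℕ (suc M)
  C′≈ : cycloSumₚ (suc (suc M)) ≈ constₚ (fromℕ (suc (suc M))) ⊕ Y ⊛ (constₚ K ⊕ Tₚ ⊛ D)
  C′≈ = begin
    cycloSumₚ (suc (suc M))
      ≈⟨ cyclo-step (suc M) ⟩
    oneₚ ⊕ Tₚ ⊛ cycloSumₚ (suc M)
      ≈⟨ ⊕-cong (≈-refl {oneₚ}) (⊛-cong T≈Y+1 C≈) ⟩
    oneₚ ⊕ (Y ⊕ oneₚ) ⊛ (constₚ K ⊕ Y ⊛ D)
      ≈⟨ solve 3 (λ K Y D → con 1ℚ :+ (Y :+ con 1ℚ) :* (K :+ Y :* D) := (con 1ℚ :+ K) :+ Y :* (K :+ (Y :+ con 1ℚ) :* D))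
           ≈-refl (constₚ K) Y D ⟩
    (oneₚ ⊕ constₚ K) ⊕ Y ⊛ (constₚ K ⊕ (Y ⊕ oneₚ) ⊛ D)
      ≈⟨ ⊕-cong (≈-sym (≈-trans (λ i → cong (λ x → constₚ x i) (fromℕ-suc (suc M))) (const-+ 1ℚ K)))
                (⊛-cong (≈-refl {Y}) (⊕-cong (≈-refl {constₚ K}) (⊛-cong (≈-sym T≈Y+1) (≈-refl {D})))) ⟩
    constₚ (fromℕ (suc (suc M))) ⊕ Y ⊛ (constₚ K ⊕ Tₚ ⊛ D) ∎

degree-Y^k : ∀ k → DegreeBelow (suc k) (powₚ Y k)
degree-Y^k zero = degree-const 1ℚ
degree-Y^k (suc k) = degree-⊛ {1} {k} degree-Y (degree-Y^k k)
  where
  degree-Y : DegreeBelow 2 Y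
  degree-Y (suc (suc i)) _ = refl
  degree-Y (suc zero) (s≤s ())

-- Partial fraction data of order k for N = M + 2, as series with degree bounds.
PartialFractionData : ℕ → ℕ → Set
PartialFractionData M k = Σ[ h ∈ PS ] Σ[ f ∈ PS ] DegreeBelow k h × DegreeBelow (suc M) f ×
  (h ⊛ cycloSumₚ (suc (suc M)) ⊕ f ⊛ powₚ Y k ≈ oneₚ)

-- From order k to k + 1: given f = v + Y·g and [N]_X = N + Y·D, the pair
-- h + w·Y^k, g - w·D with w = v/N works, since w·Y^k·[N]_X = v·Y^k + w·D·Y^{k+1}.
partialFraction-lift : ∀ M k h f v g D →
  DegreeBelow k h → DegreeBelow M g → DegreeBelow (suc M) D →
  h ⊛ cycloSumₚ (suc (suc M)) ⊕ f ⊛ powₚ Y k ≈ oneₚ →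
  f ≈ constₚ v ⊕ Y ⊛ g →
  cycloSumₚ (suc (suc M)) ≈ constₚ (fromℕ (suc (suc M))) ⊕ Y ⊛ D →
  PartialFractionData M (suc k)
partialFraction-lift M k h f v g D degH degG degD pf f≈ C≈ =
  h ⊕ cw ⊛ Yᵏ , g ⊕ negₚ (cw ⊛ D) ,
  degree-⊕ (degree-weaken (ℕP.n≤1+n k) degH) (degree-const⊛ w (degree-Y^k k)) ,
  degree-⊕ (degree-weaken (ℕP.n≤1+n M) degG) (degree-neg (degree-const⊛ w degD)) ,
  identity
  where
  open ≈-Reasoning
  open PS-Solver
  N = fromℕ (suc (suc M))
  instance N≢0 = fromℕ-nonZero (suc (suc M))
  w = v * 1/ N
  cw = constₚ w
  cN = constₚ N
  C = cycloSumₚ (suc (suc M))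
  Yᵏ = powₚ Y k
  cw⊛cN : cw ⊛ cN ≈ constₚ v
  cw⊛cN i = trans (sym (const-* w N i))
    (cong (λ x → constₚ x i) (trans (*-assoc v (1/ N) N) (trans (cong (v *_) (*-inverseˡ N)) (*-identityʳ v))))
  identity : (h ⊕ cw ⊛ Yᵏ) ⊛ C ⊕ (g ⊕ negₚ (cw ⊛ D)) ⊛ (Y ⊛ Yᵏ) ≈ oneₚ
  identity = begin
    (h ⊕ cw ⊛ Yᵏ) ⊛ C ⊕ (g ⊕ negₚ (cw ⊛ D)) ⊛ (Y ⊛ Yᵏ)
      ≈⟨ ⊕-cong (⊛-cong (≈-refl {h ⊕ cw ⊛ Yᵏ}) C≈) (≈-refl {(g ⊕ negₚ (cw ⊛ D)) ⊛ (Y ⊛ Yᵏ)}) ⟩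
    (h ⊕ cw ⊛ Yᵏ) ⊛ (cN ⊕ Y ⊛ D) ⊕ (g ⊕ negₚ (cw ⊛ D)) ⊛ (Y ⊛ Yᵏ)
      ≈⟨ solve 7 (λ h cw Yk cN Y D g → (h :+ cw :* Yk) :* (cN :+ Y :* D) :+ (g :+ :- (cw :* D)) :* (Y :* Yk)
                   := h :* (cN :+ Y :* D) :+ (cw :* cN :+ Y :* g) :* Yk) ≈-refl h cw Yᵏ cN Y D g ⟩
    h ⊛ (cN ⊕ Y ⊛ D) ⊕ (cw ⊛ cN ⊕ Y ⊛ g) ⊛ Yᵏ
      ≈⟨ ⊕-cong (⊛-cong (≈-refl {h}) (≈-sym C≈)) (⊛-cong (≈-trans (⊕-cong cw⊛cN (≈-refl {Y ⊛ g})) (≈-sym f≈)) (≈-refl {Yᵏ})) ⟩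
    h ⊛ C ⊕ f ⊛ Yᵏ
      ≈⟨ pf ⟩
    oneₚ ∎

partialFraction-step : ∀ M k → PartialFractionData M k → PartialFractionData M (suc k)
partialFraction-step M k (h , f , degH , degF , pf) =
  let v , g , degG , f≈ = divide-by-Y M f degF
      D , degD , C≈ = cyclo-at-1 (suc M)
  in partialFraction-lift M k h f v g D degH degG degD pf f≈ C≈

partialFraction-series : ∀ M k → PartialFractionData M k
partialFraction-series M zero =
  zeroₚ , oneₚ , degree-zero 0 , degree-weaken (s≤s z≤n) (degree-const 1ℚ) ,
  ≈-trans (⊕-cong (⊛-zeroˡ (cycloSumₚ (suc (suc M)))) (⊛-identityˡ oneₚ)) (λ m → +-identityˡ (oneₚ m))
partialFraction-series M (suc k) = partialFraction-step M k (partialFraction-series M k)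

partialFraction-exists : ∀ k N → 1 ≤ k → 1 ≤ N →
  Σ[ h ∈ Vec ℚ k ] Σ[ f ∈ Vec ℚ (N ∸ 1) ] IsPartialFraction k N h f
partialFraction-exists k (suc zero) k≥1 _ = coeffVec k oneₚ , []ᵥ ,
  ≈-trans (⊕-cong (⊛-cong (poly-coeffVec k oneₚ (degree-weaken k≥1 (degree-const 1ℚ))) C₁≈1) (⊛-zeroˡ (powₚ xMinus1ₚ k)))
    (λ m → trans (+-identityʳ _) (⊛-identityˡ oneₚ m))
  where
  C₁≈1 : cycloSumₚ 1 ≈ oneₚ
  C₁≈1 zero = cyclo-inside 1 0 (s≤s z≤n)
  C₁≈1 (suc i) = cyclo-outside 1 (suc i) (λ { (s≤s ()) })
partialFraction-exists k (suc (suc M)) _ _ with partialFraction-series M k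
... | h , f , degH , degF , pf = coeffVec k h , coeffVec (suc M) f ,
  ≈-trans (⊕-cong (⊛-cong (poly-coeffVec k h degH) (≈-refl {cycloSumₚ (suc (suc M))}))
                  (⊛-cong (poly-coeffVec (suc M) f degF) (≈-refl {powₚ xMinus1ₚ k})))
          pf

mainTheorem6 : (k ℓ n : ℕ) → {{_ : NonZero ℓ}} → 1 ≤ k → 1 ≤ n → ℓ ∣ n →
    (Σ[ h ∈ Vec ℚ k ] Σ[ f ∈ Vec ℚ (n / ℓ ∸ 1) ] IsPartialFraction k (n / ℓ) h f)
    × (∀ (h : Vec ℚ k) (f : Vec ℚ (n / ℓ ∸ 1)) → IsPartialFraction k (n / ℓ) h f →
        (powₚ (scaleₚ (fromℕ ℓ) Bₚ) k ⊛ scaleₚ (fromℕ n) Bₚ)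
        ≈ₚ
        (monoₚ k (fromℕ (ℓ ^ k)) ⊛ scaleₚ (fromℕ n) Bₚ ⊛ evalAtₚ f (powₚ expₚ ℓ)
          ⊕ constₚ (fromℕ (n / ℓ)) ⊛ powₚ (scaleₚ (fromℕ ℓ) Bₚ) (suc k)
            ⊛ evalAtₚ h (powₚ expₚ ℓ)))
mainTheorem6 k ℓ n k≥1 n≥1 ℓ∣n =
  partialFraction-exists k (n / ℓ) k≥1 N≥1 ,
  bernoulli-partialFraction ℓ k (n / ℓ) n (m*[n/m]≡n ℓ∣n)
  where
  N≥1 : 1 ≤ n / ℓ
  N≥1 = m≥n⇒m/n>0 (∣⇒≤ {{>-nonZero n≥1}} ℓ∣n)
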